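{- Fix a topological space $\underline{Z}$. The class $\mathbb{F}_0$ of $\equiv_0$-equivalence classes of functions $f:\underline{X}\to\underline{Z}$ ($\underline{X}$ ranging over all topological spaces), ordered by $\leq_0$, is a complete lattice: every subset has both a least upper bound and a greatest lower bound.
   Context: For functions $f:\underline{X}\to\underline{Z}$ and $g:\underline{Y}\to\underline{Z}$ between topological spaces, $f\leq_0 g$ means there is a continuous function $G:\underline{X}\to\underline{Y}$ with $f=g\circ G$; $f\equiv_0 g$ means $f\leq_0 g$ and $g\leq_0 f$. -}

module Defs where

open import Level using (Level; suc; Lift)
open import Data.Unit using (⊤)
open import Data.Product using (Σ; _×_; _,_)
open import Function using (_∘_)
open import Relation.Binary.PropositionalEquality using (_≡_)

record Space (ℓ : Level) : Set (suc (suc ℓ)) where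
  field
    Carrier : Set ℓ
    Open    : (Carrier → Set ℓ) → Set (suc ℓ)
    -- openness is a property of the subset (its extension), not of the predicate
    open-ext   : ∀ {U V : Carrier → Set ℓ} → Open U →
                 (∀ x → U x → V x) → (∀ x → V x → U x) → Open V
    open-whole : Open (λ _ → Lift ℓ ⊤)
    open-∩     : ∀ {U V : Carrier → Set ℓ} → Open U → Open V →
                 Open (λ x → U x × V x)
    open-⋃     : (J : Set ℓ) (U : J → Carrier → Set ℓ) →
                 (∀ j → Open (U j)) → Open (λ x → Σ J (λ j → U j x))

open Space public

Continuous : ∀ {ℓ} (X Y : Space ℓ) → (Carrier X → Carrier Y) → Set (suc ℓ)
Continuous X Y G = ∀ (U : Carrier Y → Set _) → Open Y U → Open X (U ∘ G)

record FnInto {ℓ} (Z : Space ℓ) : Set (suc (suc ℓ)) where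
  constructor fn
  field
    dom : Space ℓ
    fun : Carrier dom → Carrier Z

open FnInto public

_≤₀_ : ∀ {ℓ} {Z : Space ℓ} → FnInto Z → FnInto Z → Set (suc ℓ)
f ≤₀ g = Σ (Carrier (dom f) → Carrier (dom g)) λ G →
           Continuous (dom f) (dom g) G × (∀ x → fun f x ≡ fun g (G x))

_≡₀_ : ∀ {ℓ} {Z : Space ℓ} → FnInto Z → FnInto Z → Set (suc ℓ)
f ≡₀ g = (f ≤₀ g) × (g ≤₀ f)

-- Since ≡₀ is the equivalence induced by the preorder ≤₀, these are exactly
-- joins/meets of the corresponding set of ≡₀-classes in F₀.
IsLUB : ∀ {ℓ} {Z : Space ℓ} {I : Set ℓ} → (I → FnInto Z) → FnInto Z → Set (suc (suc ℓ))
IsLUB {Z = Z} f g = (∀ i → f i ≤₀ g) × (∀ (h : FnInto Z) → (∀ i → f i ≤₀ h) → g ≤₀ h)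

IsGLB : ∀ {ℓ} {Z : Space ℓ} {I : Set ℓ} → (I → FnInto Z) → FnInto Z → Set (suc (suc ℓ))
IsGLB {Z = Z} f g = (∀ i → g ≤₀ f i) × (∀ (h : FnInto Z) → (∀ i → h ≤₀ f i) → h ≤₀ g)

module Submission where

-- * Join: the disjoint sum ⨁ᵢ dom(fᵢ) with the function (i , x) ↦ fᵢ x.
--   Each fᵢ factors through it via the continuous injection, and a family of
--   reductions fᵢ ≤₀ h glues to one reduction by the copairing property of
--   the coproduct topology.
-- * Meet: the fibred product P = { (z , (xᵢ)ᵢ) | fᵢ xᵢ = z for all i } with
--   the initial topology of the projections P → dom(fᵢ), and the function
--   (z , _) ↦ z.  Each projection is a reduction to fᵢ, and a family of
--   reductions h ≤₀ fᵢ pairs into a map into P which is continuous by the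
--   universal property of the initial topology.

open import Defs
open import Data.Product using (Σ; _×_; _,_; proj₁; proj₂)
open import Level using (Level; Lift; lift)
open import Data.Unit using (⊤; tt)
open import Data.List using (List; []; _∷_; _++_)
open import Function using (_∘_)
open import Relation.Binary.PropositionalEquality using (_≡_; refl; sym)

private
  variable
    ℓ : Level

⨁ : {I : Set ℓ} → (I → Space ℓ) → Space ℓ
⨁ {I = I} X = record
  { Carrier    = Σ I (Carrier ∘ X)
  ; Open       = λ U → ∀ i → Open (X i) (λ x → U (i , x))
  ; open-ext   = λ o U⊆V V⊆U i →
      open-ext (X i) (o i) (λ x → U⊆V (i , x)) (λ x → V⊆U (i , x))
  ; open-whole = λ i → open-whole (X i)
  ; open-∩     = λ o o′ i → open-∩ (X i) (o i) (o′ i)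
  ; open-⋃     = λ J U o i → open-⋃ (X i) J (λ j x → U j (i , x)) (λ j → o j i)
  }

inject-continuous : {I : Set ℓ} (X : I → Space ℓ) (i : I) →
                    Continuous (X i) (⨁ X) (i ,_)
inject-continuous X i U o = o i

copair-continuous : {I : Set ℓ} (X : I → Space ℓ) (Y : Space ℓ)
                    (G : ∀ i → Carrier (X i) → Carrier Y) →
                    (∀ i → Continuous (X i) Y (G i)) →
                    Continuous (⨁ X) Y (λ p → G (proj₁ p) (proj₂ p))
copair-continuous X Y G G-cont U o i = G-cont i U o

-- Its opens are the unions of finite
-- intersections of preimages pⱼ⁻¹(V) of open sets V ⊆ Xⱼ.
module InitialTopology {A J : Set ℓ} (X : J → Space ℓ)
                       (p : (j : J) → A → Carrier (X j)) where

  Subbasic : Set (Level.suc ℓ)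
  Subbasic = Σ J λ j → Σ (Carrier (X j) → Set ℓ) (Open (X j))

  Basic : List Subbasic → A → Set ℓ
  Basic []                  a = Lift ℓ ⊤
  Basic ((j , V , _) ∷ bs) a = V (p j a) × Basic bs a

  Basic-∩ : ∀ bs cs a → Basic bs a → Basic cs a → Basic (bs ++ cs) a
  Basic-∩ []       cs a _        c = c
  Basic-∩ (_ ∷ bs) cs a (v , b)  c = v , Basic-∩ bs cs a b c

  Basic-++ˡ : ∀ bs cs a → Basic (bs ++ cs) a → Basic bs a
  Basic-++ˡ []       cs a _       = lift tt
  Basic-++ˡ (_ ∷ bs) cs a (v , b) = v , Basic-++ˡ bs cs a b

  Basic-++ʳ : ∀ bs cs a → Basic (bs ++ cs) a → Basic cs a
  Basic-++ʳ []       cs a b       = b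
  Basic-++ʳ (_ ∷ bs) cs a (_ , b) = Basic-++ʳ bs cs a b

  InitialOpen : (A → Set ℓ) → Set (Level.suc ℓ)
  InitialOpen U = ∀ a → U a → Σ (List Subbasic) λ bs →
                    Basic bs a × (∀ b → Basic bs b → U b)

  Initial : Space ℓ
  Initial = record
    { Carrier    = A
    ; Open       = InitialOpen
    ; open-ext   = λ o U⊆V V⊆U a v →
        let (bs , a∈bs , bs⊆U) = o a (V⊆U a v)
        in  bs , a∈bs , λ b b∈bs → U⊆V b (bs⊆U b b∈bs)
    ; open-whole = λ a _ → [] , lift tt , λ _ _ → lift tt
    ; open-∩     = λ o o′ a (u , v) →
        let (bs , a∈bs , bs⊆U) = o a u
            (cs , a∈cs , cs⊆V) = o′ a v
        in  bs ++ cs , Basic-∩ bs cs a a∈bs a∈cs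
          , λ b b∈ → bs⊆U b (Basic-++ˡ bs cs b b∈) , cs⊆V b (Basic-++ʳ bs cs b b∈)
    ; open-⋃     = λ K U o a (k , u) →
        let (bs , a∈bs , bs⊆U) = o k a u
        in  bs , a∈bs , λ b b∈bs → k , bs⊆U b b∈bs
    }

  proj-continuous : ∀ j → Continuous Initial (X j) (p j)
  proj-continuous j V o a v = ((j , V , o) ∷ []) , (v , lift tt) , λ b b∈ → proj₁ b∈

  module _ (W : Space ℓ) (G : Carrier W → A)
           (pG-cont : ∀ j → Continuous W (X j) (p j ∘ G)) where

    preimage-Basic-open : ∀ bs → Open W (Basic bs ∘ G)
    preimage-Basic-open []                  = open-whole W
    preimage-Basic-open ((j , V , o) ∷ bs) =
      open-∩ W (pG-cont j V o) (preimage-Basic-open bs)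

    -- G⁻¹(U) is the union, over points w ∈ G⁻¹(U), of the preimages of the
    -- basic neighbourhoods of G w witnessing that U is open.
    into-Initial-continuous : Continuous W Initial G
    into-Initial-continuous U o =
      open-ext W (open-⋃ W Index nbhd (λ (w , u) → preimage-Basic-open (basis w u)))
        (λ v ((w , u) , v∈) → proj₂ (proj₂ (o (G w) u)) (G v) v∈)
        (λ w u → (w , u) , proj₁ (proj₂ (o (G w) u)))
      where
        Index : Set _
        Index = Σ (Carrier W) (U ∘ G)

        basis : ∀ w → U (G w) → List Subbasic
        basis w u = proj₁ (o (G w) u)

        nbhd : Index → Carrier W → Set _
        nbhd (w , u) = Basic (basis w u) ∘ G

module _ {Z : Space ℓ} {I : Set ℓ} (f : I → FnInto Z) where

  join : FnInto Z
  join = fn (⨁ (dom ∘ f)) (λ (i , x) → fun (f i) x)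

  join-isLUB : IsLUB f join
  join-isLUB = upper , least
    where
      upper : ∀ i → f i ≤₀ join
      upper i = (i ,_) , inject-continuous (dom ∘ f) i , λ _ → refl

      least : ∀ h → (∀ i → f i ≤₀ h) → join ≤₀ h
      least h fᵢ≤h =
          (λ (i , x) → proj₁ (fᵢ≤h i) x)
        , copair-continuous (dom ∘ f) (dom h) (proj₁ ∘ fᵢ≤h) (proj₁ ∘ proj₂ ∘ fᵢ≤h)
        , λ (i , x) → proj₂ (proj₂ (fᵢ≤h i)) x

  FibredProduct : Set ℓ
  FibredProduct = Σ (Carrier Z) λ z → ∀ i → Σ (Carrier (dom (f i))) λ x → fun (f i) x ≡ z

  component : ∀ i → FibredProduct → Carrier (dom (f i))
  component i (_ , xs) = proj₁ (xs i)

  open InitialTopology (dom ∘ f) component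

  meet : FnInto Z
  meet = fn Initial proj₁

  meet-isGLB : IsGLB f meet
  meet-isGLB = lower , greatest
    where
      lower : ∀ i → meet ≤₀ f i
      lower i = component i , proj-continuous i , λ (_ , xs) → sym (proj₂ (xs i))

      greatest : ∀ h → (∀ i → h ≤₀ f i) → h ≤₀ meet
      greatest h h≤fᵢ = pair , into-Initial-continuous (dom h) pair (proj₁ ∘ proj₂ ∘ h≤fᵢ)
                      , λ _ → refl
        where
          pair : Carrier (dom h) → FibredProduct
          pair w = fun h w , λ i → proj₁ (h≤fᵢ i) w , sym (proj₂ (proj₂ (h≤fᵢ i)) w)

theorem4p16 : ∀ {ℓ} (Z : Space ℓ) (I : Set ℓ) (f : I → FnInto Z) →
                Σ (FnInto Z) (IsLUB f) × Σ (FnInto Z) (IsGLB f)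
theorem4p16 Z I f = (join f , join-isLUB f) , (meet f , meet-isGLB f)
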